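{- Every JIS graph is an edge move distance graph; that is, for every JIS graph $G$ there is a finite set $S$ of pairwise non-isomorphic graphs, all with the same number of vertices and the same number of edges, such that $G$ is isomorphic to the edge move distance graph $D_m(S)$.
   Context: All graphs are finite and simple. A graph $G$ is called JIS if there exist a positive integer $n$ and an assignment of an $n$-element set $S_v$ to each vertex $v$ of $G$ such that distinct vertices receive distinct sets, and for distinct vertices $v,w$, $v$ and $w$ are adjacent iff $|S_v \cap S_w| = n-1$. An edge move on a graph consists of removing one edge and adding a new edge (one not currently present) without changing the vertex set. For graphs $G,H$ of the same order and size, the edge move distance $d_m(G,H)$ is the fewest number of edge moves needed to transform $G$ into a graph isomorphic to $H$. For a set $S$ of graphs of the same order and size, the edge move distance graph $D_m(S)$ has vertex set $S$, with two elements adjacent iff their edge move distance is $1$. A graph is an edge move distance graph if it is isomorphic to some $D_m(S)$. -}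

module Defs where

open import Data.Bool using (Bool; true; false; if_then_else_; _∧_)
open import Data.Nat using (ℕ; _≤_; _∸_; _<ᵇ_)
open import Data.Fin using (Fin; toℕ)
open import Data.Fin.Subset using (Subset; _∩_; ∣_∣)
open import Data.List using (List; map; allFin)
open import Data.Nat.ListAction using (sum)
open import Data.Product using (Σ; ∃; _×_; _,_)
open import Data.Sum using (_⊎_)
open import Function.Bundles using (_↔_; Inverse; _⇔_)
open import Function.Definitions using (Injective)
open import Relation.Nullary using (¬_)
open import Relation.Binary.PropositionalEquality using (_≡_; _≢_)

record Graph (n : ℕ) : Set where
  field
    adj    : Fin n → Fin n → Bool
    sym    : ∀ i j → adj i j ≡ adj j i
    irrefl : ∀ i → adj i i ≡ false
open Graph public

_≅_ : {n m : ℕ} → Graph n → Graph m → Set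
_≅_ {n} {m} G H =
  Σ (Fin n ↔ Fin m) λ σ → ∀ i j → adj H (Inverse.to σ i) (Inverse.to σ j) ≡ adj G i j

edgeCount : {n : ℕ} → Graph n → ℕ
edgeCount {n} G =
  sum (map (λ i → sum (map (λ j → if (toℕ i <ᵇ toℕ j) ∧ adj G i j then 1 else 0)
                          (allFin n)))
           (allFin n))

JIS : {p : ℕ} → Graph p → Set
JIS {p} G =
  Σ ℕ λ N → Σ ℕ λ k → (1 ≤ k) × Σ (Fin p → Subset N) λ S →
    (∀ v → ∣ S v ∣ ≡ k) × Injective _≡_ _≡_ S ×
    (∀ v w → v ≢ w → ((adj G v w ≡ true) ⇔ (∣ S v ∩ S w ∣ ≡ k ∸ 1)))

SamePair : {n : ℕ} → Fin n → Fin n → Fin n → Fin n → Set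
SamePair x y a b = (x ≡ a × y ≡ b) ⊎ (x ≡ b × y ≡ a)

EdgeMove : {n : ℕ} → Graph n → Graph n → Set
EdgeMove {n} G G' =
  Σ (Fin n) λ a → Σ (Fin n) λ b → Σ (Fin n) λ c → Σ (Fin n) λ d →
    adj G a b ≡ true × adj G c d ≡ false × c ≢ d ×
    (∀ x y → SamePair x y a b → adj G' x y ≡ false) ×
    (∀ x y → SamePair x y c d → adj G' x y ≡ true) ×
    (∀ x y → ¬ SamePair x y a b → ¬ SamePair x y c d → adj G' x y ≡ adj G x y)

EdgeMoveDist1 : {n : ℕ} → Graph n → Graph n → Set
EdgeMoveDist1 G H = ¬ (G ≅ H) × Σ (Graph _) λ G' → EdgeMove G G' × (G' ≅ H)

IsEdgeMoveDistanceGraph : {p : ℕ} → Graph p → Set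
IsEdgeMoveDistanceGraph {p} G =
  Σ ℕ λ k → Σ ℕ λ q → Σ (Fin k → Graph q) λ F →
    (∀ i j → i ≢ j → ¬ (F i ≅ F j)) ×
    (∀ i j → edgeCount (F i) ≡ edgeCount (F j)) ×
    Σ (Fin p ↔ Fin k) λ σ →
      ∀ v w → (adj G v w ≡ true) ⇔ EdgeMoveDist1 (F (Inverse.to σ v)) (F (Inverse.to σ w))

module Submission where

-- Let G be JIS, witnessed by distinct k-subsets S v of Fin N with v ~ w iff
-- |S v ∩ S w| = k - 1, that is, iff S v and S w differ by a single exchange
-- of one element for another (johnson-adjacency).  To a set A ⊆ Fin N we
-- attach a gadget graph: spokes X m — Y m, present iff m ∈ A, and b m = N + 2m
-- pendant neighbours P r of each X m.  The degree of X m is b m or b m + 1,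
-- so it records both m and whether m ∈ A, while Y and P vertices have degree
-- at most N.  Then:
--   * gadgets of sets of equal size have equally many edges (handshake lemma);
--   * for i ∈ A ∖ B, gadget B has fewer vertices of degree ≥ b i + 1 than
--     gadget A, so distinct sets give non-isomorphic gadgets;
--   * gadget A is one edge move away from a copy of gadget B iff A and B
--     differ by a single exchange: moving the spoke of i to j realises an
--     exchange; conversely an edge move lowers that count only through an
--     endpoint of the removed edge, which must be X i, so at most one
--     element leaves A.
-- Hence v ↦ gadget (S v) represents G as an edge move distance graph.


open import Defs hiding (sym)
open import Data.Bool using (Bool; true; false; if_then_else_; _∧_; not)
import Data.Bool as Bool
open import Data.Bool.Properties using (¬-not; ∧-comm; T-≡)
open import Data.Nat using (ℕ; zero; suc; _+_; _*_; _∸_; _≤_; _<_; z≤n; s≤s; _<ᵇ_; _≤ᵇ_)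
open import Data.Nat.Properties hiding (_≟_)
open import Data.Fin using (Fin; zero; suc; toℕ; _≟_; punchIn; punchOut; _↑ˡ_; _↑ʳ_; splitAt)
open import Data.Fin.Properties
  using (toℕ-injective; toℕ<n; punchInᵢ≢i; punchIn-punchOut; ¬∀⟶∃¬; any?;
         splitAt-↑ˡ; splitAt-↑ʳ; splitAt⁻¹-↑ˡ; splitAt⁻¹-↑ʳ)
open import Data.Fin.Subset using (Subset; _∩_; ∣_∣)
open import Data.Vec using ([]; _∷_; lookup)
open import Data.Vec.Properties using (lookup-zipWith; tabulate∘lookup; tabulate-cong)
open import Data.List using (map; tabulate; allFin)
import Data.Nat.ListAction as List
open import Data.Product using (∃; _×_; _,_; proj₁)
open import Data.Sum using (_⊎_; inj₁; inj₂; [_,_]′)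
open import Data.Empty using (⊥-elim)
open import Function.Base using (_∘_)
open import Function.Bundles using (Inverse; Equivalence; _⇔_; mk⇔)
open import Function.Construct.Identity using (↔-id)
open import Function.Properties.Equivalence using (⇔-setoid)
open import Level using (0ℓ)
open import Relation.Nullary using (¬_; yes; no; does; contradiction)
open import Relation.Nullary.Decidable using (dec-true; dec-false; _×-dec_; _⊎-dec_)
open import Relation.Binary using (tri<; tri≈; tri>)
open import Relation.Binary.PropositionalEquality
open import Algebra.Properties.CommutativeMonoid.Sum +-0-commutativeMonoid
  using (sum; sum-cong-≗; sum-remove; sum-replicate-zero; sum-permute; ∑-distrib-+; ∑-comm)

𝟙 : Bool → ℕ
𝟙 b = if b then 1 else 0

count : ∀ {n} → (Fin n → Bool) → ℕ
count P = sum (λ i → 𝟙 (P i))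

𝟙≤1 : ∀ b → 𝟙 b ≤ 1
𝟙≤1 true  = s≤s z≤n
𝟙≤1 false = z≤n

listSum-tabulate : ∀ {A : Set} {n} (f : A → ℕ) (g : Fin n → A) →
                   List.sum (map f (tabulate g)) ≡ sum (f ∘ g)
listSum-tabulate {n = zero}  f g = refl
listSum-tabulate {n = suc n} f g = cong (f (g zero) +_) (listSum-tabulate f (g ∘ suc))

listSum-allFin : ∀ {n} (f : Fin n → ℕ) → List.sum (map f (allFin n)) ≡ sum f
listSum-allFin f = listSum-tabulate f (λ i → i)

sum-mono : ∀ {n} {f g : Fin n → ℕ} → (∀ i → f i ≤ g i) → sum f ≤ sum g
sum-mono {zero}  f≤g = z≤n
sum-mono {suc n} f≤g = +-mono-≤ (f≤g zero) (sum-mono (f≤g ∘ suc))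

sum-↑ : ∀ m {n} (f : Fin (m + n) → ℕ) →
        sum f ≡ sum (λ i → f (i ↑ˡ n)) + sum (λ j → f (m ↑ʳ j))
sum-↑ zero    f = refl
sum-↑ (suc m) f = trans (cong (f zero +_) (sum-↑ m (f ∘ suc))) (sym (+-assoc (f zero) _ _))

sum-elem : ∀ {n} (f : Fin n → ℕ) i → f i ≤ sum f
sum-elem {suc n} f i = ≤-trans (m≤m+n (f i) _) (≤-reflexive (sym (sum-remove f)))

sum-witness : ∀ {n} (f g : Fin n → ℕ) → sum f < sum g → ∃ λ i → f i < g i
sum-witness {n} f g lt with ¬∀⟶∃¬ n (λ i → g i ≤ f i) (λ i → g i ≤? f i)
                                   (λ g≤f → <⇒≱ lt (sum-mono g≤f))
... | i , g≰f = i , ≰⇒> g≰f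

𝟙-mono : ∀ {b c} → (b ≡ true → c ≡ true) → 𝟙 b ≤ 𝟙 c
𝟙-mono {false} _   = z≤n
𝟙-mono {true}  b⇒c rewrite b⇒c refl = ≤-refl

count≤n : ∀ {n} (P : Fin n → Bool) → count P ≤ n
count≤n {zero}  P = z≤n
count≤n {suc n} P = +-mono-≤ (𝟙≤1 (P zero)) (count≤n (P ∘ suc))

count-mono : ∀ {n} {P Q : Fin n → Bool} → (∀ i → P i ≡ true → Q i ≡ true) →
             count P ≤ count Q
count-mono P⇒Q = sum-mono (λ i → 𝟙-mono (P⇒Q i))

count-none : ∀ {n} {P : Fin n → Bool} → (∀ i → P i ≡ false) → count P ≡ 0
count-none {n} P≡false = trans (sum-cong-≗ (λ i → cong 𝟙 (P≡false i))) (sum-replicate-zero n)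

count-only-at : ∀ {n} (P : Fin n → Bool) i → (∀ j → j ≢ i → P j ≡ false) →
                count P ≡ 𝟙 (P i)
count-only-at {suc n} P i only-i = begin
  count P                                     ≡⟨ sum-remove (𝟙 ∘ P) ⟩
  𝟙 (P i) + count (P ∘ punchIn i)             ≡⟨ cong (𝟙 (P i) +_) rest≡0 ⟩
  𝟙 (P i) + 0                                 ≡⟨ +-identityʳ _ ⟩
  𝟙 (P i)                                     ∎
  where
  open ≡-Reasoning
  rest≡0 : count (P ∘ punchIn i) ≡ 0
  rest≡0 = count-none (λ j → only-i (punchIn i j) (punchInᵢ≢i i j))

count-strict : ∀ {n} {P Q : Fin n → Bool} → (∀ i → P i ≡ true → Q i ≡ true) →
               ∀ i → P i ≡ false → Q i ≡ true → count P < count Q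
count-strict {suc n} {P} {Q} P⇒Q i Pi Qi = begin-strict
  count P                          ≡⟨ sum-remove (𝟙 ∘ P) ⟩
  𝟙 (P i) + count (P ∘ punchIn i)  ≡⟨ cong (λ b → 𝟙 b + count (P ∘ punchIn i)) Pi ⟩
  count (P ∘ punchIn i)            ≤⟨ count-mono (P⇒Q ∘ punchIn i) ⟩
  count (Q ∘ punchIn i)            <⟨ n<1+n _ ⟩
  1 + count (Q ∘ punchIn i)        ≡⟨ cong (λ b → 𝟙 b + count (Q ∘ punchIn i)) Qi ⟨
  𝟙 (Q i) + count (Q ∘ punchIn i)  ≡⟨ sum-remove (𝟙 ∘ Q) ⟨
  count Q                          ∎
  where open ≤-Reasoning

count-witness : ∀ {n} (P Q : Fin n → Bool) → count P < count Q →
                ∃ λ i → P i ≡ false × Q i ≡ true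
count-witness P Q lt with sum-witness (𝟙 ∘ P) (𝟙 ∘ Q) lt
... | i , lt-i = i , indicator-gap (P i) (Q i) lt-i
  where
  indicator-gap : ∀ b c → 𝟙 b < 𝟙 c → b ≡ false × c ≡ true
  indicator-gap false true _ = refl , refl
  indicator-gap true  true (s≤s ())
  indicator-gap b false ()

count-pos : ∀ {n} (P : Fin n → Bool) → 0 < count P → ∃ λ i → P i ≡ true
count-pos {n} P pos with count-witness (λ _ → false) P
                           (subst (_< count P) (sym (count-none {n} (λ _ → refl))) pos)
... | i , _ , Pi = i , Pi

count-two : ∀ {n} (P : Fin n → Bool) {i j} → i ≢ j → P i ≡ true → P j ≡ true →
            2 ≤ count P
count-two {suc n} P {i} {j} i≢j Pi Pj = begin
  2                                   ≤⟨ +-mono-≤ (≤-reflexive (cong 𝟙 (sym Pi))) Pj-counted ⟩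
  𝟙 (P i) + count (P ∘ punchIn i)     ≡⟨ sum-remove (𝟙 ∘ P) ⟨
  count P                             ∎
  where
  open ≤-Reasoning
  j′ : Fin n
  j′ = punchOut i≢j
  Pj-counted : 1 ≤ count (P ∘ punchIn i)
  Pj-counted = begin
    1                        ≡⟨ cong 𝟙 (trans (sym Pj) (cong P (sym (punchIn-punchOut i≢j)))) ⟩
    𝟙 (P (punchIn i j′))     ≤⟨ sum-elem (𝟙 ∘ P ∘ punchIn i) j′ ⟩
    count (P ∘ punchIn i)    ∎

count≡1 : ∀ {n} (P : Fin n → Bool) → count P ≡ 1 →
          ∃ λ i → P i ≡ true × (∀ j → P j ≡ true → j ≡ i)
count≡1 P once with count-pos P (≤-reflexive (sym once))
... | i , Pi = i , Pi , unique
  where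
  unique : ∀ j → P j ≡ true → j ≡ i
  unique j Pj with j ≟ i
  ... | yes j≡i = j≡i
  ... | no  j≢i = ⊥-elim (<-irrefl (sym once) (≤-trans (s≤s (s≤s z≤n)) (count-two P j≢i Pj Pi)))

count≡0 : ∀ {n} (P : Fin n → Bool) → count P ≡ 0 → ∀ i → P i ≡ false
count≡0 P none i with P i in Pi
... | false = refl
... | true  = ⊥-elim (1+n≰n (≤-trans (≤-reflexive (cong 𝟙 (sym Pi)))
                                     (≤-trans (sum-elem (𝟙 ∘ P) i) (≤-reflexive none))))

count-atMostOne : ∀ {n} (P : Fin n → Bool) → (∀ i j → P i ≡ true → P j ≡ true → i ≡ j) →
                  count P ≤ 1
count-atMostOne P unique with any? (λ i → P i Bool.≟ true)
... | yes (i , Pi) = ≤-reflexive (trans (count-only-at P i off-i) (cong 𝟙 Pi))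
  where
  off-i : ∀ j → j ≢ i → P j ≡ false
  off-i j j≢i = ¬-not (λ Pj → j≢i (unique j i Pj Pi))
... | no none = ≤-trans (≤-reflexive (count-none (λ j → ¬-not (λ Pj → none (j , Pj))))) z≤n

count-split : ∀ {n} (P Q : Fin n → Bool) →
              count P ≡ count (λ i → P i ∧ Q i) + count (λ i → P i ∧ not (Q i))
count-split P Q = trans (sum-cong-≗ (λ i → split (P i) (Q i)))
                        (∑-distrib-+ (λ i → 𝟙 (P i ∧ Q i)) (λ i → 𝟙 (P i ∧ not (Q i))))
  where
  split : ∀ b c → 𝟙 b ≡ 𝟙 (b ∧ c) + 𝟙 (b ∧ not c)
  split true  true  = refl
  split true  false = refl
  split false c     = refl

count-below : ∀ n b → b ≤ n → count {n} (λ r → toℕ r <ᵇ b) ≡ b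
count-below zero    zero    _       = refl
count-below (suc n) zero    _       = count-none {suc n} (λ _ → refl)
count-below (suc n) (suc b) (s≤s b≤n) = cong suc (count-below n b b≤n)

count-except-one : ∀ {n} {P Q : Fin n → Bool} i → (∀ j → j ≢ i → P j ≡ true → Q j ≡ true) →
                   count P ≤ suc (count Q)
count-except-one {suc n} {P} {Q} i P⇒Q = begin
  count P                                ≡⟨ sum-remove (𝟙 ∘ P) ⟩
  𝟙 (P i) + count (P ∘ punchIn i)        ≤⟨ +-mono-≤ (𝟙≤1 (P i))
                                                      (count-mono (λ j → P⇒Q (punchIn i j) (punchInᵢ≢i i j))) ⟩
  suc (count (Q ∘ punchIn i))            ≤⟨ s≤s (m≤n+m _ (𝟙 (Q i))) ⟩
  suc (𝟙 (Q i) + count (Q ∘ punchIn i))  ≡⟨ cong suc (sum-remove (𝟙 ∘ Q)) ⟨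
  suc (count Q)                          ∎
  where open ≤-Reasoning

_∖_ : ∀ {n} → (Fin n → Bool) → (Fin n → Bool) → Fin n → Bool
(A ∖ B) m = A m ∧ not (B m)

OneSwap : ∀ {n} → (Fin n → Bool) → (Fin n → Bool) → Set
OneSwap A B = ∃ λ i → ∃ λ j → A i ≡ true × B i ≡ false × B j ≡ true × A j ≡ false ×
                                (∀ m → m ≢ i → m ≢ j → A m ≡ B m)

∖-true : ∀ {n} (A B : Fin n → Bool) m → (A ∖ B) m ≡ true → A m ≡ true × B m ≡ false
∖-true A B m m∈A∖B with A m | B m
∖-true A B m refl | true | false = refl , refl

∖-balanced : ∀ {n} (A B : Fin n → Bool) → count A ≡ count B →
             count (A ∖ B) ≡ count (B ∖ A)
∖-balanced A B |A|≡|B| = +-cancelˡ-≡ (count (λ m → A m ∧ B m)) _ _ (begin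
  count (λ m → A m ∧ B m) + count (A ∖ B)  ≡⟨ count-split A B ⟨
  count A                                  ≡⟨ |A|≡|B| ⟩
  count B                                  ≡⟨ count-split B A ⟩
  count (λ m → B m ∧ A m) + count (B ∖ A)  ≡⟨ cong (_+ count (B ∖ A))
                                                   (sum-cong-≗ (λ m → cong 𝟙 (∧-comm (B m) (A m)))) ⟩
  count (λ m → A m ∧ B m) + count (B ∖ A)  ∎)
  where open ≡-Reasoning

distinct⇒∖-nonempty : ∀ {n} (A B : Fin n → Bool) → count A ≡ count B →
                      ¬ (∀ m → A m ≡ B m) → 0 < count (A ∖ B)
distinct⇒∖-nonempty A B |A|≡|B| A≢B = n≢0⇒n>0 λ A∖B≡0 → A≢B λ m →
  agree (A m) (B m) (count≡0 (A ∖ B) A∖B≡0 m)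
                    (count≡0 (B ∖ A) (trans (sym (∖-balanced A B |A|≡|B|)) A∖B≡0) m)
  where
  agree : ∀ a b → a ∧ not b ≡ false → b ∧ not a ≡ false → a ≡ b
  agree true  true  _ _ = refl
  agree false false _ _ = refl

oneSwap⇒∖≡1 : ∀ {n} (A B : Fin n → Bool) → OneSwap A B → count (A ∖ B) ≡ 1
oneSwap⇒∖≡1 A B (i , j , Ai , Bi , _ , Aj , same) =
  trans (count-only-at (A ∖ B) i off-i) (cong₂ (λ a b → 𝟙 (a ∧ not b)) Ai Bi)
  where
  off-i : ∀ m → m ≢ i → (A ∖ B) m ≡ false
  off-i m m≢i with m ≟ j
  ... | yes refl = cong (λ a → a ∧ not (B m)) Aj
  ... | no  m≢j  = trans (cong (λ b → A m ∧ not b) (sym (same m m≢i m≢j))) (self (A m))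
    where
    self : ∀ a → a ∧ not a ≡ false
    self true  = refl
    self false = refl

∖≡1⇒oneSwap : ∀ {n} (A B : Fin n → Bool) → count (A ∖ B) ≡ 1 → count (B ∖ A) ≡ 1 →
              OneSwap A B
∖≡1⇒oneSwap A B A∖B≡1 B∖A≡1 with count≡1 (A ∖ B) A∖B≡1 | count≡1 (B ∖ A) B∖A≡1
... | i , i∈A∖B , only-i | j , j∈B∖A , only-j with ∖-true A B i i∈A∖B | ∖-true B A j j∈B∖A
... | Ai , Bi | Bj , Aj = i , j , Ai , Bi , Bj , Aj , same
  where
  same : ∀ m → m ≢ i → m ≢ j → A m ≡ B m
  same m m≢i m≢j with A m in Am | B m in Bm
  ... | true  | true  = refl
  ... | false | false = refl
  ... | true  | false = ⊥-elim (m≢i (only-i m (cong₂ (λ a b → a ∧ not b) Am Bm)))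
  ... | false | true  = ⊥-elim (m≢j (only-j m (cong₂ (λ b a → b ∧ not a) Bm Am)))

johnson-adjacency : ∀ {n k} (A B : Fin n → Bool) → count A ≡ k → count B ≡ k → 1 ≤ k →
                    (count (λ m → A m ∧ B m) ≡ k ∸ 1) ⇔ OneSwap A B
johnson-adjacency {k = k} A B |A|≡k |B|≡k 1≤k = mk⇔ meet⇒swap swap⇒meet
  where
  I D : ℕ
  I = count (λ m → A m ∧ B m)
  D = count (A ∖ B)
  size : k ≡ I + D
  size = trans (sym |A|≡k) (count-split A B)

  meet⇒swap : I ≡ k ∸ 1 → OneSwap A B
  meet⇒swap I≡k-1 =
    ∖≡1⇒oneSwap A B D≡1 (trans (sym (∖-balanced A B (trans |A|≡k (sym |B|≡k)))) D≡1)
    where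
    D≡1 : D ≡ 1
    D≡1 = +-cancelˡ-≡ (k ∸ 1) D 1 (begin
      k ∸ 1 + D   ≡⟨ cong (_+ D) I≡k-1 ⟨
      I + D       ≡⟨ size ⟨
      k           ≡⟨ m∸n+n≡m 1≤k ⟨
      k ∸ 1 + 1   ∎)
      where open ≡-Reasoning

  swap⇒meet : OneSwap A B → I ≡ k ∸ 1
  swap⇒meet swap = begin
    I             ≡⟨ m+n∸n≡m I 1 ⟨
    I + 1 ∸ 1     ≡⟨ cong (λ d → I + d ∸ 1) (oneSwap⇒∖≡1 A B swap) ⟨
    I + D ∸ 1     ≡⟨ cong (_∸ 1) size ⟨
    k ∸ 1         ∎
    where open ≡-Reasoning

atMostOne⇒oneSwap : ∀ {n} (A B : Fin n → Bool) → count A ≡ count B → ¬ (∀ m → A m ≡ B m) →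
                    (∀ i j → (A ∖ B) i ≡ true → (A ∖ B) j ≡ true → i ≡ j) → OneSwap A B
atMostOne⇒oneSwap A B |A|≡|B| A≢B unique =
  ∖≡1⇒oneSwap A B D≡1 (trans (sym (∖-balanced A B |A|≡|B|)) D≡1)
  where
  D≡1 : count (A ∖ B) ≡ 1
  D≡1 = ≤-antisym (count-atMostOne (A ∖ B) unique) (distinct⇒∖-nonempty A B |A|≡|B| A≢B)

degree : ∀ {q} → Graph q → Fin q → ℕ
degree G x = count (adj G x)

atLeast : ∀ {q} → ℕ → Graph q → ℕ
atLeast t G = count (λ x → t ≤ᵇ degree G x)

≤ᵇ-true : ∀ {t d} → t ≤ d → (t ≤ᵇ d) ≡ true
≤ᵇ-true {t} {d} = dec-true (t ≤? d)

≤ᵇ-false : ∀ {t d} → d < t → (t ≤ᵇ d) ≡ false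
≤ᵇ-false {t} {d} d<t = dec-false (t ≤? d) (<⇒≱ d<t)

≤ᵇ-sound : ∀ {t d} → (t ≤ᵇ d) ≡ true → t ≤ d
≤ᵇ-sound {t} {d} t≤ᵇd = ≤ᵇ⇒≤ t d (Equivalence.from T-≡ t≤ᵇd)

≅-refl : ∀ {q} (G : Graph q) → G ≅ G
≅-refl {q} G = ↔-id (Fin q) , λ _ _ → refl

degree-iso : ∀ {p q} {G : Graph p} {H : Graph q} (iso : G ≅ H) x →
             degree H (Inverse.to (proj₁ iso) x) ≡ degree G x
degree-iso {G = G} {H} (σ , σ-adj) x = begin
  degree H (to x)                      ≡⟨ sum-permute (𝟙 ∘ adj H (to x)) σ ⟩
  sum (λ y → 𝟙 (adj H (to x) (to y)))  ≡⟨ sum-cong-≗ (λ y → cong 𝟙 (σ-adj x y)) ⟩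
  degree G x                           ∎
  where
  open ≡-Reasoning
  open Inverse σ using (to)

atLeast-iso : ∀ {p q} t {G : Graph p} {H : Graph q} → G ≅ H → atLeast t H ≡ atLeast t G
atLeast-iso t {G} {H} iso@(σ , _) =
  trans (sum-permute (λ u → 𝟙 (t ≤ᵇ degree H u)) σ)
        (sum-cong-≗ (λ x → cong (λ d → 𝟙 (t ≤ᵇ d)) (degree-iso {G = G} {H} iso x)))

edgeCount≡ : ∀ {q} (G : Graph q) → edgeCount G ≡ sum (λ i → count (λ j → (toℕ i <ᵇ toℕ j) ∧ adj G i j))
edgeCount≡ {q} G = trans (listSum-allFin (λ i → List.sum (map (forward i) (allFin q))))
                          (sum-cong-≗ (λ i → listSum-allFin (forward i)))
  where
  forward : Fin q → Fin q → ℕ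
  forward i j = 𝟙 ((toℕ i <ᵇ toℕ j) ∧ adj G i j)

-- Handshake lemma: the degrees add up to twice the number of edges.  Each
-- edge {i, j} with i < j is counted once from i and once from j.
handshake : ∀ {q} (G : Graph q) → 2 * edgeCount G ≡ sum (degree G)
handshake {q} G = begin
  2 * edgeCount G                                ≡⟨ cong (2 *_) (edgeCount≡ G) ⟩
  2 * E                                          ≡⟨ cong (E +_) (+-identityʳ E) ⟩
  E + E                                          ≡⟨ cong (E +_) (∑-comm (λ j i → below j i)) ⟩
  E + sum (λ i → sum (λ j → below j i))          ≡⟨ ∑-distrib-+ (λ i → sum (below i)) (λ i → sum (λ j → below j i)) ⟨
  sum (λ i → sum (below i) + sum (λ j → below j i))
                                                 ≡⟨ sum-cong-≗ (λ i → ∑-distrib-+ (below i) (λ j → below j i)) ⟨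
  sum (λ i → sum (λ j → below i j + below j i))  ≡⟨ sum-cong-≗ (λ i → sum-cong-≗ (orient i)) ⟨
  sum (degree G)                                 ∎
  where
  open ≡-Reasoning
  below : Fin q → Fin q → ℕ
  below i j = 𝟙 ((toℕ i <ᵇ toℕ j) ∧ adj G i j)
  E : ℕ
  E = sum (λ i → sum (below i))

  orient : ∀ i j → 𝟙 (adj G i j) ≡ below i j + below j i
  orient i j with <-cmp (toℕ i) (toℕ j)
  ... | tri< i<j _ j≮i rewrite dec-true (toℕ i <? toℕ j) i<j | dec-false (toℕ j <? toℕ i) j≮i =
    sym (+-identityʳ _)
  ... | tri> i≮j _ j<i rewrite dec-false (toℕ i <? toℕ j) i≮j | dec-true (toℕ j <? toℕ i) j<i =
    cong 𝟙 (Graph.sym G i j)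
  ... | tri≈ i≮j i≡j _ rewrite toℕ-injective i≡j | dec-false (toℕ j <? toℕ j) i≮j =
    cong 𝟙 (irrefl G j)

edgeCount-from-degrees : ∀ {p q} (G : Graph p) (H : Graph q) →
                         sum (degree G) ≡ sum (degree H) → edgeCount G ≡ edgeCount H
edgeCount-from-degrees G H same = *-cancelˡ-≡ (edgeCount G) (edgeCount H) 2
  (trans (handshake G) (trans same (sym (handshake H))))

-- The pair removed by an edge move, and its endpoints.  (The graphs are
-- explicit arguments: they cannot be recovered from the unfolded type of a move.)
Removed : ∀ {q} (G G' : Graph q) → EdgeMove G G' → Fin q → Fin q → Set
Removed G G' (a , b , _) x y = SamePair x y a b

Endpoint : ∀ {q} (G G' : Graph q) → EdgeMove G G' → Fin q → Set
Endpoint G G' (a , b , _) u = u ≡ a ⊎ u ≡ b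

edge-survives : ∀ {q} (G G' : Graph q) (mv : EdgeMove G G') x y → ¬ Removed G G' mv x y →
                adj G x y ≡ true → adj G' x y ≡ true
edge-survives G G' (a , b , c , d , _ , _ , _ , _ , cd∈G' , unchanged) x y not-ab xy∈G
  with (x ≟ c ×-dec y ≟ d) ⊎-dec (x ≟ d ×-dec y ≟ c)
... | yes added   = cd∈G' x y added
... | no  unmoved = trans (unchanged x y not-ab unmoved) xy∈G

degree-drop≤1 : ∀ {q} (G G' : Graph q) (mv : EdgeMove G G') x → degree G x ≤ suc (degree G' x)
degree-drop≤1 G G' mv@(a , b , _) x with x ≟ a
... | yes x≡a = count-except-one b λ y y≢b → edge-survives G G' mv x y λ where
  (inj₁ (_ , y≡b))   → y≢b y≡b
  (inj₂ (x≡b , y≡a)) → y≢b (trans y≡a (trans (sym x≡a) x≡b))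
... | no x≢a = count-except-one a λ y y≢a → edge-survives G G' mv x y λ where
  (inj₁ (x≡a , _)) → x≢a x≡a
  (inj₂ (_ , y≡a)) → y≢a y≡a

degree-drop⇒endpoint : ∀ {q} (G G' : Graph q) (mv : EdgeMove G G') u →
                       degree G' u < degree G u → Endpoint G G' mv u
degree-drop⇒endpoint G G' mv@(a , b , _) u drop
  with count-witness (adj G' u) (adj G u) drop
... | y , uy∉G' , uy∈G with (u ≟ a ×-dec y ≟ b) ⊎-dec (u ≟ b ×-dec y ≟ a)
...   | yes (inj₁ (u≡a , _)) = inj₁ u≡a
...   | yes (inj₂ (u≡b , _)) = inj₂ u≡b
...   | no  kept with trans (sym (edge-survives G G' mv u y kept uy∈G)) uy∉G'
...     | ()

threshold-crossing : ∀ {q} t (G G' : Graph q) (mv : EdgeMove G G') → atLeast t G' < atLeast t G →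
                     ∃ λ u → degree G u ≡ t × Endpoint G G' mv u
threshold-crossing t G G' mv drop
  with count-witness (λ x → t ≤ᵇ degree G' x) (λ x → t ≤ᵇ degree G x) drop
... | u , below-in-G' , above-in-G = u , ≤-antisym (≤-trans (degree-drop≤1 G G' mv u) d'<t) t≤d ,
                                     degree-drop⇒endpoint G G' mv u (<-≤-trans d'<t t≤d)
  where
  t≤d : t ≤ degree G u
  t≤d = ≤ᵇ-sound above-in-G
  d'<t : degree G' u < t
  d'<t = ≰⇒> (λ t≤d' → contradiction (trans (sym (≤ᵇ-true t≤d')) below-in-G') λ ())

endpoints-adjacent : ∀ {q} (G G' : Graph q) (mv : EdgeMove G G') {u u'} →
                     Endpoint G G' mv u → Endpoint G G' mv u' → u ≢ u' → adj G u u' ≡ true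
endpoints-adjacent G G' mv (inj₁ refl) (inj₁ refl) u≢u' = ⊥-elim (u≢u' refl)
endpoints-adjacent G G' (_ , _ , _ , _ , ab∈G , _) (inj₁ refl) (inj₂ refl) _ = ab∈G
endpoints-adjacent G G' (a , b , _ , _ , ab∈G , _) (inj₂ refl) (inj₁ refl) _ =
  trans (Graph.sym G b a) ab∈G
endpoints-adjacent G G' mv (inj₂ refl) (inj₂ refl) u≢u' = ⊥-elim (u≢u' refl)

module Gadget (N : ℕ) where

  R : ℕ
  R = N + 2 * N

  Q : ℕ
  Q = N + (N + R)

  data Kind : Set where
    X Y : Fin N → Kind
    P   : Fin R → Kind

  vertex : Kind → Fin Q
  vertex (X m) = m ↑ˡ (N + R)
  vertex (Y m) = N ↑ʳ (m ↑ˡ R)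
  vertex (P r) = N ↑ʳ (N ↑ʳ r)

  kind : Fin Q → Kind
  kind u = [ X , [ Y , P ]′ ∘ splitAt N ]′ (splitAt N u)

  kind-vertex : ∀ κ → kind (vertex κ) ≡ κ
  kind-vertex (X m) rewrite splitAt-↑ˡ N m (N + R) = refl
  kind-vertex (Y m) rewrite splitAt-↑ʳ N (N + R) (m ↑ˡ R) | splitAt-↑ˡ N m R = refl
  kind-vertex (P r) rewrite splitAt-↑ʳ N (N + R) (N ↑ʳ r) | splitAt-↑ʳ N R r = refl

  vertex-injective : ∀ {κ λ′} → vertex κ ≡ vertex λ′ → κ ≡ λ′
  vertex-injective {κ} {λ′} eq = trans (sym (kind-vertex κ)) (trans (cong kind eq) (kind-vertex λ′))

  vertex-kind : ∀ u → vertex (kind u) ≡ u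
  vertex-kind u with splitAt N u in split-u
  ... | inj₁ m = splitAt⁻¹-↑ˡ split-u
  ... | inj₂ v with splitAt N v in split-v
  ...   | inj₁ m = trans (cong (N ↑ʳ_) (splitAt⁻¹-↑ˡ split-v)) (splitAt⁻¹-↑ʳ split-u)
  ...   | inj₂ r = trans (cong (N ↑ʳ_) (splitAt⁻¹-↑ʳ split-v)) (splitAt⁻¹-↑ʳ split-u)

  sum-by-kind : (g : Kind → ℕ) → sum (g ∘ kind) ≡ sum (g ∘ X) + (sum (g ∘ Y) + sum (g ∘ P))
  sum-by-kind g = begin
    sum (g ∘ kind)                                     ≡⟨ sum-↑ N (g ∘ kind) ⟩
    sum (g′ ∘ X) + sum (λ v → g (kind (N ↑ʳ v)))        ≡⟨ cong (sum (g′ ∘ X) +_) (sum-↑ N (λ v → g (kind (N ↑ʳ v)))) ⟩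
    sum (g′ ∘ X) + (sum (g′ ∘ Y) + sum (g′ ∘ P))        ≡⟨ cong₂ _+_ (at X) (cong₂ _+_ (at Y) (at P)) ⟩
    sum (g ∘ X) + (sum (g ∘ Y) + sum (g ∘ P))           ∎
    where
    open ≡-Reasoning
    g′ : Kind → ℕ
    g′ = g ∘ kind ∘ vertex
    at : ∀ {n} (κ : Fin n → Kind) → sum (g′ ∘ κ) ≡ sum (g ∘ κ)
    at κ = sum-cong-≗ (λ i → cong g (kind-vertex (κ i)))

  -- X m carries b m pendant neighbours; these numbers are N apart from
  -- the small degrees and pairwise at least two apart.
  b : Fin N → ℕ
  b m = N + 2 * toℕ m

  b≤R : ∀ m → b m ≤ R
  b≤R m = +-monoʳ-≤ N (*-monoʳ-≤ 2 (<⇒≤ (toℕ<n m)))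

  link : (Fin N → Bool) → Kind → Kind → Bool
  link A (X m) (Y m′) = does (m ≟ m′) ∧ A m
  link A (Y m′) (X m) = does (m ≟ m′) ∧ A m
  link A (X m) (P r)  = toℕ r <ᵇ b m
  link A (P r) (X m)  = toℕ r <ᵇ b m
  link A _ _          = false

  link-sym : ∀ A κ λ′ → link A κ λ′ ≡ link A λ′ κ
  link-sym A (X m) (X m′) = refl
  link-sym A (X m) (Y m′) = refl
  link-sym A (X m) (P r)  = refl
  link-sym A (Y m) (X m′) = refl
  link-sym A (Y m) (Y m′) = refl
  link-sym A (Y m) (P r)  = refl
  link-sym A (P r) (X m)  = refl
  link-sym A (P r) (Y m)  = refl
  link-sym A (P r) (P r′) = refl

  link-irrefl : ∀ A κ → link A κ κ ≡ false
  link-irrefl A (X m) = refl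
  link-irrefl A (Y m) = refl
  link-irrefl A (P r) = refl

  gadget : (Fin N → Bool) → Graph Q
  gadget A = record
    { adj    = λ u v → link A (kind u) (kind v)
    ; sym    = λ u v → link-sym A (kind u) (kind v)
    ; irrefl = λ u → link-irrefl A (kind u)
    }

  kdeg : (Fin N → Bool) → Kind → ℕ
  kdeg A κ = count (λ v → link A κ (kind v))

  spoke-count : ∀ (A : Fin N → Bool) m → count (λ m′ → does (m ≟ m′) ∧ A m) ≡ 𝟙 (A m)
  spoke-count A m = trans (count-only-at (λ m′ → does (m ≟ m′) ∧ A m) m
                                         (λ m′ m′≢m → cong (_∧ A m) (dec-false (m ≟ m′) (m′≢m ∘ sym))))
                          (cong (λ c → 𝟙 (c ∧ A m)) (dec-true (m ≟ m) refl))

  spoke-count′ : ∀ (A : Fin N → Bool) m′ → count (λ m → does (m ≟ m′) ∧ A m) ≡ 𝟙 (A m′)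
  spoke-count′ A m′ = trans (count-only-at (λ m → does (m ≟ m′) ∧ A m) m′
                                           (λ m m≢m′ → cong (_∧ A m) (dec-false (m ≟ m′) m≢m′)))
                            (cong (λ c → 𝟙 (c ∧ A m′)) (dec-true (m′ ≟ m′) refl))

  kdeg-X : ∀ A m → kdeg A (X m) ≡ 𝟙 (A m) + b m
  kdeg-X A m = begin
    kdeg A (X m)                                   ≡⟨ sum-by-kind (𝟙 ∘ link A (X m)) ⟩
    count {N} (λ _ → false) + (spokes + pendants)  ≡⟨ cong₂ (λ x y → x + (y + pendants))
                                                             (count-none {N} (λ _ → refl)) (spoke-count A m) ⟩
    𝟙 (A m) + pendants                             ≡⟨ cong (𝟙 (A m) +_) (count-below R (b m) (b≤R m)) ⟩
    𝟙 (A m) + b m                                  ∎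
    where
    open ≡-Reasoning
    spokes pendants : ℕ
    spokes   = count (λ m′ → does (m ≟ m′) ∧ A m)
    pendants = count {R} (λ r → toℕ r <ᵇ b m)

  only-X-neighbours : ∀ A κ → (∀ m → link A κ (Y m) ≡ false) → (∀ r → link A κ (P r) ≡ false) →
                      kdeg A κ ≡ count (λ m → link A κ (X m))
  only-X-neighbours A κ no-Y no-P = begin
    kdeg A κ                                                    ≡⟨ sum-by-kind (𝟙 ∘ link A κ) ⟩
    count (link A κ ∘ X) + (count (link A κ ∘ Y) + count (link A κ ∘ P))
                                                                ≡⟨ cong₂ (λ y z → count (link A κ ∘ X) + (y + z)) (count-none no-Y) (count-none no-P) ⟩
    count (link A κ ∘ X) + 0                                    ≡⟨ +-identityʳ _ ⟩
    count (link A κ ∘ X)                                        ∎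
    where open ≡-Reasoning

  kdeg-Y : ∀ A m → kdeg A (Y m) ≡ 𝟙 (A m)
  kdeg-Y A m = trans (only-X-neighbours A (Y m) (λ _ → refl) (λ _ → refl)) (spoke-count′ A m)

  kdeg-small : ∀ A κ → (∀ m → κ ≢ X m) → kdeg A κ ≤ N
  kdeg-small A (X m) not-X = contradiction refl (not-X m)
  kdeg-small A (Y m) _ = begin
    kdeg A (Y m)   ≡⟨ kdeg-Y A m ⟩
    𝟙 (A m)        ≤⟨ 𝟙≤1 (A m) ⟩
    1              ≤⟨ ≤-trans (s≤s z≤n) (toℕ<n m) ⟩
    N              ∎
    where open ≤-Reasoning
  kdeg-small A (P r) _ = begin
    kdeg A (P r)                   ≡⟨ only-X-neighbours A (P r) (λ _ → refl) (λ _ → refl) ⟩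
    count (link A (P r) ∘ X)       ≤⟨ count≤n (link A (P r) ∘ X) ⟩
    N                              ∎
    where open ≤-Reasoning

  kdeg-P : ∀ A B r → kdeg A (P r) ≡ kdeg B (P r)
  kdeg-P A B r = sum-cong-≗ (λ v → cong 𝟙 (P-link (kind v)))
    where
    P-link : ∀ κ → link A (P r) κ ≡ link B (P r) κ
    P-link (X m) = refl
    P-link (Y m) = refl
    P-link (P r′) = refl

  degree-sum : ∀ A → sum (degree (gadget A)) ≡ (count A + sum b) + (count A + sum (kdeg A ∘ P))
  degree-sum A = begin
    sum (kdeg A ∘ kind)                                        ≡⟨ sum-by-kind (kdeg A) ⟩
    sum (kdeg A ∘ X) + (sum (kdeg A ∘ Y) + sum (kdeg A ∘ P))   ≡⟨ cong₂ (λ x y → x + (y + sum (kdeg A ∘ P)))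
                                                                         (trans (sum-cong-≗ (kdeg-X A)) (∑-distrib-+ (𝟙 ∘ A) b))
                                                                         (sum-cong-≗ (kdeg-Y A)) ⟩
    (count A + sum b) + (count A + sum (kdeg A ∘ P))           ∎
    where open ≡-Reasoning

  gadget-edgeCount : ∀ A B → count A ≡ count B → edgeCount (gadget A) ≡ edgeCount (gadget B)
  gadget-edgeCount A B |A|≡|B| = edgeCount-from-degrees (gadget A) (gadget B) (begin
    sum (degree (gadget A))                            ≡⟨ degree-sum A ⟩
    (count A + sum b) + (count A + sum (kdeg A ∘ P))   ≡⟨ cong₂ (λ c d → (c + sum b) + (c + d)) |A|≡|B| (sum-cong-≗ (kdeg-P A B)) ⟩
    (count B + sum b) + (count B + sum (kdeg B ∘ P))   ≡⟨ degree-sum B ⟨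
    sum (degree (gadget B))                            ∎)
    where open ≡-Reasoning

  threshold : Fin N → ℕ
  threshold i = suc (b i)

  -- Consecutive pendant counts differ by two, so the degrees 𝟙 (A m) + b m
  -- of different X vertices never meet.
  b-gap : ∀ c {i m} → toℕ i < toℕ m → 𝟙 c + b i < b m
  b-gap c {i} {m} i<m = begin-strict
    𝟙 c + b i                    ≤⟨ +-monoˡ-≤ (b i) (𝟙≤1 c) ⟩
    suc (b i)                    <⟨ n<1+n _ ⟩
    suc (suc (N + 2 * toℕ i))    ≡⟨ cong suc (+-suc N _) ⟨
    suc (N + suc (2 * toℕ i))    ≡⟨ +-suc N _ ⟨
    N + suc (suc (2 * toℕ i))    ≡⟨ cong (N +_) (*-suc 2 (toℕ i)) ⟨
    N + 2 * suc (toℕ i)          ≤⟨ +-monoʳ-≤ N (*-monoʳ-≤ 2 i<m) ⟩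
    b m                          ∎
    where open ≤-Reasoning

  small<threshold : ∀ {d} i → d ≤ N → d < threshold i
  small<threshold i d≤N = s≤s (≤-trans d≤N (m≤m+n N _))

  threshold-identifies : ∀ A i κ → kdeg A κ ≡ threshold i → κ ≡ X i
  threshold-identifies A i (X m) deg≡t with <-cmp (toℕ m) (toℕ i)
  ... | tri< m<i _ _ = contradiction (trans (sym (kdeg-X A m)) deg≡t) (<⇒≢ (<-trans (b-gap (A m) m<i) (n<1+n _)))
  ... | tri≈ _ m≡i _ = cong X (toℕ-injective m≡i)
  ... | tri> _ _ i<m = contradiction (trans (sym deg≡t) (kdeg-X A m)) (<⇒≢ (≤-trans (b-gap true i<m) (m≤n+m (b m) (𝟙 (A m)))))
  threshold-identifies A i (Y m) deg≡t = contradiction deg≡t (<⇒≢ (small<threshold i (kdeg-small A (Y m) λ _ ())))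
  threshold-identifies A i (P r) deg≡t = contradiction deg≡t (<⇒≢ (small<threshold i (kdeg-small A (P r) λ _ ())))

  threshold-monotone : ∀ A B i → B i ≡ false → ∀ κ → threshold i ≤ kdeg B κ → threshold i ≤ kdeg A κ
  threshold-monotone A B i Bi (X m) t≤deg with <-cmp (toℕ m) (toℕ i)
  ... | tri< m<i _ _ = contradiction (≤-trans t≤deg (≤-reflexive (kdeg-X B m))) (<⇒≱ (<-trans (b-gap (B m) m<i) (n<1+n _)))
  ... | tri≈ _ m≡i _ rewrite toℕ-injective m≡i | kdeg-X B i | Bi = contradiction t≤deg 1+n≰n
  ... | tri> _ _ i<m = ≤-trans (<⇒≤ (b-gap true i<m)) (≤-trans (m≤n+m (b m) (𝟙 (A m))) (≤-reflexive (sym (kdeg-X A m))))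
  threshold-monotone A B i Bi (Y m) t≤deg = contradiction t≤deg (<⇒≱ (small<threshold i (kdeg-small B (Y m) λ _ ())))
  threshold-monotone A B i Bi (P r) t≤deg = contradiction t≤deg (<⇒≱ (small<threshold i (kdeg-small B (P r) λ _ ())))

  located : ∀ u {κ} → kind u ≡ κ → u ≡ vertex κ
  located u kind≡κ = trans (sym (vertex-kind u)) (cong vertex kind≡κ)

  -- For i ∈ A ∖ B, fewer vertices of gadget B than of gadget A have degree
  -- at least threshold i: X i is lost.
  threshold-drop : ∀ A B i → A i ≡ true → B i ≡ false →
                   atLeast (threshold i) (gadget B) < atLeast (threshold i) (gadget A)
  threshold-drop A B i Ai Bi = count-strict reached-in-A (vertex (X i)) missed-by-X reached-by-X
    where
    reached-in-A : ∀ u → (threshold i ≤ᵇ kdeg B (kind u)) ≡ true → (threshold i ≤ᵇ kdeg A (kind u)) ≡ true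
    reached-in-A u t≤deg = ≤ᵇ-true (threshold-monotone A B i Bi (kind u) (≤ᵇ-sound t≤deg))
    missed-by-X : (threshold i ≤ᵇ kdeg B (kind (vertex (X i)))) ≡ false
    missed-by-X rewrite kind-vertex (X i) | kdeg-X B i | Bi = ≤ᵇ-false (n<1+n (b i))
    reached-by-X : (threshold i ≤ᵇ kdeg A (kind (vertex (X i)))) ≡ true
    reached-by-X rewrite kind-vertex (X i) | kdeg-X A i | Ai = ≤ᵇ-true (≤-refl {suc (b i)})

  gadget-nonIso : ∀ A B i → A i ≡ true → B i ≡ false → ¬ (gadget A ≅ gadget B)
  gadget-nonIso A B i Ai Bi iso =
    <-irrefl (atLeast-iso (threshold i) {gadget A} {gadget B} iso) (threshold-drop A B i Ai Bi)

  gadget-distinct : ∀ A B → count A ≡ count B → ¬ (∀ m → A m ≡ B m) → ¬ (gadget A ≅ gadget B)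
  gadget-distinct A B |A|≡|B| A≢B =
    let (i , i∈A∖B) = count-pos (A ∖ B) (distinct⇒∖-nonempty A B |A|≡|B| A≢B)
        (Ai , Bi)   = ∖-true A B i i∈A∖B
    in  gadget-nonIso A B i Ai Bi

  X-injective : ∀ {i j} → vertex (X i) ≡ vertex (X j) → i ≡ j
  X-injective {i} {j} eq with vertex-injective {X i} {X j} eq
  ... | refl = refl

  -- If one edge move turns gadget A into a copy of gadget B, then X i is an
  -- endpoint of the removed edge for each i ∈ A ∖ B ...
  X-is-endpoint : ∀ A B {G'} (mv : EdgeMove (gadget A) G') → G' ≅ gadget B →
                  ∀ i → A i ≡ true → B i ≡ false → Endpoint (gadget A) G' mv (vertex (X i))
  X-is-endpoint A B {G'} mv iso i Ai Bi =
    let (u , deg≡t , endpoint) = threshold-crossing (threshold i) (gadget A) G' mv drop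
    in  subst (Endpoint (gadget A) G' mv) (located u (threshold-identifies A i (kind u) deg≡t)) endpoint
    where
    drop : atLeast (threshold i) G' < atLeast (threshold i) (gadget A)
    drop = subst (_< atLeast (threshold i) (gadget A)) (atLeast-iso (threshold i) {G'} {gadget B} iso)
                 (threshold-drop A B i Ai Bi)

  -- ... so A ∖ B has at most one element, the X vertices being pairwise
  -- non-adjacent while the removed edge joins its endpoints.
  removed-once : ∀ A B {G'} → EdgeMove (gadget A) G' → G' ≅ gadget B →
                 ∀ i j → (A ∖ B) i ≡ true → (A ∖ B) j ≡ true → i ≡ j
  removed-once A B {G'} mv iso i j i∈A∖B j∈A∖B with i ≟ j
  ... | yes i≡j = i≡j
  ... | no  i≢j = contradiction (endpoints-adjacent (gadget A) G' mv (endpoint i i∈A∖B) (endpoint j j∈A∖B)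
                                                    (i≢j ∘ X-injective))
                                (X-X-nonadjacent i j)
    where
    endpoint : ∀ m → (A ∖ B) m ≡ true → Endpoint (gadget A) G' mv (vertex (X m))
    endpoint m m∈A∖B = let (Am , Bm) = ∖-true A B m m∈A∖B in X-is-endpoint A B {G'} mv iso m Am Bm
    X-X-nonadjacent : ∀ m m′ → adj (gadget A) (vertex (X m)) (vertex (X m′)) ≢ true
    X-X-nonadjacent m m′ rewrite kind-vertex (X m) | kind-vertex (X m′) = λ ()

  spoke : ∀ A m → adj (gadget A) (vertex (X m)) (vertex (Y m)) ≡ A m
  spoke A m rewrite kind-vertex (X m) | kind-vertex (Y m) = cong (_∧ A m) (dec-true (m ≟ m) refl)

  spoke-pair : ∀ A m x y → SamePair x y (vertex (X m)) (vertex (Y m)) → adj (gadget A) x y ≡ A m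
  spoke-pair A m _ _ (inj₁ (refl , refl)) = spoke A m
  spoke-pair A m _ _ (inj₂ (refl , refl)) =
    trans (Graph.sym (gadget A) (vertex (Y m)) (vertex (X m))) (spoke A m)

  link-disagreement : ∀ A B κ λ′ → link A κ λ′ ≢ link B κ λ′ →
                      ∃ λ m → A m ≢ B m × ((κ ≡ X m × λ′ ≡ Y m) ⊎ (κ ≡ Y m × λ′ ≡ X m))
  link-disagreement A B (X m) (Y m′) differ with m ≟ m′
  ... | yes refl = m , differ , inj₁ (refl , refl)
  ... | no  _    = contradiction refl differ
  link-disagreement A B (Y m′) (X m) differ with m ≟ m′
  ... | yes refl = m , differ , inj₂ (refl , refl)
  ... | no  _    = contradiction refl differ
  link-disagreement A B (X m) (X m′) differ = contradiction refl differ
  link-disagreement A B (X m) (P r)  differ = contradiction refl differ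
  link-disagreement A B (Y m) (Y m′) differ = contradiction refl differ
  link-disagreement A B (Y m) (P r)  differ = contradiction refl differ
  link-disagreement A B (P r) (X m)  differ = contradiction refl differ
  link-disagreement A B (P r) (Y m)  differ = contradiction refl differ
  link-disagreement A B (P r) (P r′) differ = contradiction refl differ

  adj-disagreement : ∀ A B x y → adj (gadget A) x y ≢ adj (gadget B) x y →
                     ∃ λ m → A m ≢ B m × SamePair x y (vertex (X m)) (vertex (Y m))
  adj-disagreement A B x y differ with link-disagreement A B (kind x) (kind y) differ
  ... | m , Am≢Bm , inj₁ (x:X , y:Y) = m , Am≢Bm , inj₁ (located x x:X , located y y:Y)
  ... | m , Am≢Bm , inj₂ (x:Y , y:X) = m , Am≢Bm , inj₂ (located x x:Y , located y y:X)

  -- A single exchange i ↦ j is realised by the edge move that deletes the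
  -- spoke of i and inserts the spoke of j.
  oneSwap⇒move : ∀ A B → OneSwap A B → EdgeMove (gadget A) (gadget B)
  oneSwap⇒move A B (i , j , Ai , Bi , Bj , Aj , same) =
    vertex (X i) , vertex (Y i) , vertex (X j) , vertex (Y j) ,
    trans (spoke A i) Ai , trans (spoke A j) Aj , X≢Y ,
    (λ x y spoke-i → trans (spoke-pair B i x y spoke-i) Bi) ,
    (λ x y spoke-j → trans (spoke-pair B j x y spoke-j) Bj) ,
    unchanged
    where
    X≢Y : vertex (X j) ≢ vertex (Y j)
    X≢Y eq with vertex-injective {X j} {Y j} eq
    ... | ()
    unchanged : ∀ x y → ¬ SamePair x y (vertex (X i)) (vertex (Y i)) →
                ¬ SamePair x y (vertex (X j)) (vertex (Y j)) → adj (gadget B) x y ≡ adj (gadget A) x y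
    unchanged x y not-i not-j with adj (gadget B) x y Bool.≟ adj (gadget A) x y
    ... | yes agree = agree
    ... | no  differ with adj-disagreement A B x y (differ ∘ sym)
    ...   | m , Am≢Bm , spoke-m with m ≟ i | m ≟ j
    ...     | yes refl | _        = contradiction spoke-m not-i
    ...     | no  _    | yes refl = contradiction spoke-m not-j
    ...     | no  m≢i  | no  m≢j  = contradiction (same m m≢i m≢j) Am≢Bm

  gadget-distance-one : ∀ A B → count A ≡ count B → ¬ (∀ m → A m ≡ B m) →
                        EdgeMoveDist1 (gadget A) (gadget B) ⇔ OneSwap A B
  gadget-distance-one A B |A|≡|B| A≢B = mk⇔ move⇒swap swap⇒move
    where
    move⇒swap : EdgeMoveDist1 (gadget A) (gadget B) → OneSwap A B
    move⇒swap (_ , G' , mv , iso) =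
      atMostOne⇒oneSwap A B |A|≡|B| A≢B (removed-once A B {G'} mv iso)
    swap⇒move : OneSwap A B → EdgeMoveDist1 (gadget A) (gadget B)
    swap⇒move swap@(i , _ , Ai , Bi , _) =
      gadget-nonIso A B i Ai Bi , gadget B , oneSwap⇒move A B swap , ≅-refl (gadget B)

∣∣≡count : ∀ {n} (s : Subset n) → ∣ s ∣ ≡ count (lookup s)
∣∣≡count []          = refl
∣∣≡count (true ∷ s)  = cong suc (∣∣≡count s)
∣∣≡count (false ∷ s) = ∣∣≡count s

∣∩∣≡count : ∀ {n} (s s′ : Subset n) → ∣ s ∩ s′ ∣ ≡ count (λ m → lookup s m ∧ lookup s′ m)
∣∩∣≡count s s′ = trans (∣∣≡count (s ∩ s′)) (sum-cong-≗ (λ m → cong 𝟙 (lookup-zipWith _∧_ m s s′)))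

distinct-subsets : ∀ {n} {s s′ : Subset n} → s ≢ s′ → ¬ (∀ m → lookup s m ≡ lookup s′ m)
distinct-subsets {s = s} {s′} s≢s′ same =
  s≢s′ (trans (sym (tabulate∘lookup s)) (trans (tabulate-cong same) (tabulate∘lookup s′)))

proposition11 : {p : ℕ} (G : Graph p) → JIS G → IsEdgeMoveDistanceGraph G
proposition11 {p} G (N , k , 1≤k , S , |S|≡k , S-injective , jis) =
  p , Q , F , F-distinct , F-size , ↔-id (Fin p) , adjacency
  where
  open Gadget N
  χ : Fin p → Fin N → Bool
  χ v = lookup (S v)

  |χ|≡k : ∀ v → count (χ v) ≡ k
  |χ|≡k v = trans (sym (∣∣≡count (S v))) (|S|≡k v)

  same-size : ∀ v w → count (χ v) ≡ count (χ w)
  same-size v w = trans (|χ|≡k v) (sym (|χ|≡k w))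

  χ-distinct : ∀ {v w} → v ≢ w → ¬ (∀ m → χ v m ≡ χ w m)
  χ-distinct v≢w = distinct-subsets (v≢w ∘ S-injective)

  F : Fin p → Graph Q
  F v = gadget (χ v)

  F-distinct : ∀ v w → v ≢ w → ¬ (F v ≅ F w)
  F-distinct v w v≢w = gadget-distinct (χ v) (χ w) (same-size v w) (χ-distinct v≢w)

  F-size : ∀ v w → edgeCount (F v) ≡ edgeCount (F w)
  F-size v w = gadget-edgeCount (χ v) (χ w) (same-size v w)

  adjacency : ∀ v w → (adj G v w ≡ true) ⇔ EdgeMoveDist1 (F v) (F w)
  adjacency v w with v ≟ w
  ... | yes refl = mk⇔ (λ loop → contradiction (trans (sym loop) (irrefl G v)) λ ())
                       (λ (not-self , _) → contradiction (≅-refl (F v)) not-self)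
  ... | no  v≢w  = begin
    adj G v w ≡ true                                  ≈⟨ jis v w v≢w ⟩
    ∣ S v ∩ S w ∣ ≡ k ∸ 1                             ≈⟨ mk⇔ (trans (sym meet)) (trans meet) ⟩
    count (λ m → χ v m ∧ χ w m) ≡ k ∸ 1               ≈⟨ johnson-adjacency (χ v) (χ w) (|χ|≡k v) (|χ|≡k w) 1≤k ⟩
    OneSwap (χ v) (χ w)                               ≈⟨ gadget-distance-one (χ v) (χ w) (same-size v w) (χ-distinct v≢w) ⟨
    EdgeMoveDist1 (F v) (F w)                         ∎
    where
    open import Relation.Binary.Reasoning.Setoid (⇔-setoid 0ℓ)
    meet : ∣ S v ∩ S w ∣ ≡ count (λ m → χ v m ∧ χ w m)
    meet = ∣∩∣≡count (S v) (S w)
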